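{- Let $n$ be a positive even integer and let $$f(x) = (x - x^2 - x^3)x^{\frac{3^n-1}{2}} - x + x^2 \in \mathbb{F}_{3^n}[x],$$ which is a permutation polynomial of $\mathbb{F}_{3^n}$. Then the inverse of $f(x)$ on $\mathbb{F}_{3^n}$ is $$f^{ -1}(x) = x^{3^{n-1}} \left(x^{\frac{3^n-1}{2}} + 1\right) + \left(\sum_{j=0}^{n-1} \sum_{k=0}^{n-1} (-1)^{j+k} x^{\frac{3^j+3^k}{2}}\right) \left(x^{\frac{3^n-1}{2}} - 1\right),$$ that is, $f^{ -1}(f(c)) = c$ for every $c \in \mathbb{F}_{3^n}$. Furthermore, the reversed Dickson polynomial $D_{3^n+5}(1,x)$ is a permutation polynomial of $\mathbb{F}_{3^n}$, and its inverse on $\mathbb{F}_{3^n}$ is $D_{3^n+5}^{ -1}(1,x) = 1 - f^{ -1}(x+1)$.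
   Context: For a prime power $q$, a polynomial $g \in \mathbb{F}_q[x]$ is a permutation polynomial (PP) of $\mathbb{F}_q$ if it induces a bijection of $\mathbb{F}_q$. The inverse of a PP $g$ on $\mathbb{F}_q$ is a polynomial $g^{ -1}(x) \in \mathbb{F}_q[x]$ with $g^{ -1}(g(c)) = c$ for all $c \in \mathbb{F}_q$; it is unique modulo $x^q - x$. For an integer $m \ge 1$, the $m$-th reversed Dickson polynomial is $$D_m(a,x) = \sum_{i=0}^{\lfloor m/2 \rfloor} \frac{m}{m-i}\binom{m-i}{i} (-1)^i a^{m-2i} x^i,$$ where $\frac{m}{m-i}\binom{m-i}{i}$ is an integer. One has $D_{3^n+5}(1,x) = f(1-x) - 1$. -}

module Defs where

open import Level using (Level; _⊔_)
open import Data.Nat using (ℕ; zero; suc; _∸_; _/_)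
import Data.Nat as ℕ
open import Data.Nat.Combinatorics using (_C_)
open import Data.Fin using (Fin)
open import Data.Product using (∃)
open import Relation.Nullary using (¬_)
import Relation.Binary.PropositionalEquality as PE
open import Algebra.Bundles using (CommutativeRing)
open import Function.Bundles using (Inverse)
import Function.Definitions as FD

-- A finite field with exactly q elements: a commutative ring in which 0 ≉ 1,
-- every nonzero element is invertible, and whose carrier (as a setoid) is in
-- bijection with Fin q.  (For q = 3^n this is F_{3^n}, unique up to iso.)
record FiniteField (q : ℕ) (c ℓ : Level) : Set (Level.suc (c ⊔ ℓ)) where
  field
    cring : CommutativeRing c ℓ
  open CommutativeRing cring
  field
    0≉1      : ¬ (0# ≈ 1#)
    inverse  : ∀ x → ¬ (x ≈ 0#) → ∃ λ y → (x * y) ≈ 1#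
    card     : Inverse setoid (PE.setoid (Fin q))

module Poly {c ℓ : Level} (R : CommutativeRing c ℓ) where
  open CommutativeRing R

  pow : Carrier → ℕ → Carrier
  pow x zero    = 1#
  pow x (suc k) = x * pow x k

  natR : ℕ → Carrier
  natR zero    = 0#
  natR (suc k) = 1# + natR k

  sumTo : ℕ → (ℕ → Carrier) → Carrier
  sumTo zero    g = 0#
  sumTo (suc n) g = sumTo n g + g n

  sgn : ℕ → Carrier
  sgn k = pow (- 1#) k

  half : ℕ → ℕ
  half n = (3 ℕ.^ n ∸ 1) / 2

  f : ℕ → Carrier → Carrier
  f n x = ((x - pow x 2) - pow x 3) * pow x (half n) - x + pow x 2

  finv : ℕ → Carrier → Carrier
  finv n x =
    pow x (3 ℕ.^ (n ∸ 1)) * (pow x (half n) + 1#)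
    + sumTo n (λ j → sumTo n (λ k →
         sgn (j ℕ.+ k) * pow x ((3 ℕ.^ j ℕ.+ 3 ℕ.^ k) / 2)))
      * (pow x (half n) - 1#)

  -- integer coefficient  m/(m-i) * binom(m-i, i)  (exact division; 0 if m-i = 0,
  -- which never occurs for 0 ≤ i ≤ ⌊m/2⌋, m ≥ 1)
  dcoeff : ℕ → ℕ → ℕ
  dcoeff m i with m ∸ i
  ... | zero  = 0
  ... | suc k = (m ℕ.* (suc k C i)) / suc k

  revDickson : ℕ → Carrier → Carrier → Carrier
  revDickson m a x = sumTo (suc (m / 2)) (λ i →
    natR (dcoeff m i) * sgn i * pow a (m ∸ 2 ℕ.* i) * pow x i)

  IsPerm : (Carrier → Carrier) → Set (c ⊔ ℓ)
  IsPerm g = FD.Bijective _≈_ _≈_ g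

-- Let h = (3ⁿ - 1)/2 and η(x) = xʰ, the quadratic character. For x ≠ 0, η(x) = ±1 by Fermat. On squares
-- f(x) = -x³ and on non-squares f(x) = x(x + 1)²; as n is even, -1 is a square, so y = f(x) has η(y) = η(x).
-- Writing S(y) = Σⱼ (-1)ʲ y^((3ʲ-1)/2), the claimed inverse is y^(3ⁿ⁻¹)(η(y) + 1) + y S(y)² (η(y) - 1): on squares
-- it gives -2x = x by x^(3ⁿ) = x, and on non-squares the Frobenius identity (x + 1)^(3ʲ) = x^(3ʲ) + 1 makes
-- (x + 1) S(x(x + 1)²) telescope to -1, so that y S(y)² = x.
-- The reversed Dickson polynomials satisfy D_{k+2} = D_{k+1} - x D_k, which in characteristic 3 is solved by
-- -Re uᵏ for u = -(1 + √(1 - x)) in the ring of numbers a + b √(1 - x). Frobenius gives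
-- u^(3ⁿ) = -1 - (1 - x)ʰ √(1 - x), and expanding u^(3ⁿ+5) yields D_{3ⁿ+5}(1,x) = f(1 - x) - 1.
-- Both maps have left inverses on a finite field, hence are permutations.
module Submission where

open import Defs
open import Level using (Level)
open import Data.Nat using (ℕ; zero; suc; _^_; _∸_; _≤_; _<_; s≤s; z≤n)
import Data.Nat as ℕ
import Data.Nat.Properties as ℕ
open import Data.Nat.DivMod using (m/n≡1+[m∸n]/n; /-monoˡ-≤; m/n≤m)
open import Data.Nat.Divisibility using (_∣_; divides)
open import Data.Nat.Combinatorics using (_C_)
open import Data.Fin as Fin using (Fin)
import Data.Fin.Properties as Fin
open import Data.Fin.Permutation using (Permutation)
open import Data.Product using (_×_; _,_; ∃; proj₁; proj₂)
open import Data.Product.Relation.Binary.Pointwise.NonDependent using (×-setoid)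
open import Data.Sum using (_⊎_; inj₁; inj₂)
open import Data.Maybe using (Maybe; just; nothing)
open import Data.Empty using (⊥-elim)
open import Function.Base using (_∘_)
open import Function.Bundles using (Inverse; mk↔ₛ′)
open import Function.Definitions using (Injective; Congruent)
open import Relation.Nullary using (¬_; yes; no)
open import Relation.Binary.Bundles using (Setoid)
open import Relation.Binary.Definitions using (Decidable)
open import Relation.Binary.PropositionalEquality as ≡ using (_≡_; _≢_)
open import Algebra.Bundles using (CommutativeRing; RawRing)
open import Algebra.Solver.Ring.AlmostCommutativeRing using (fromCommutativeRing; _-Raw-AlmostCommutative⟶_)
import Algebra.Properties.CommutativeMonoid.Sum as CommutativeMonoidSum

module Arithmetic where

  open import Data.Nat
  open import Data.Nat.Properties
  open import Data.Nat.DivMod using (m*n/n≡m; n/n≡1)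
  open import Data.Nat.Combinatorics using (nCk+nC[k+1]≡[n+1]C[k+1]; nC1≡n)
  open import Data.Nat.Divisibility using (∣m∣n⇒∣m+n; ∣n⇒∣m*n)
  open import Data.Nat.Solver using (module +-*-Solver)
  open import Relation.Binary.PropositionalEquality
  open +-*-Solver using (solve; _:+_; _:*_; _:=_; con)
  open ≡-Reasoning

  ⌊3^_/2⌋ : ℕ → ℕ
  ⌊3^ zero /2⌋  = 0
  ⌊3^ suc j /2⌋ = suc (3 * ⌊3^ j /2⌋)

  3^≡1+2*⌊3^/2⌋ : ∀ j → 3 ^ j ≡ suc (⌊3^ j /2⌋ + ⌊3^ j /2⌋)
  3^≡1+2*⌊3^/2⌋ zero    = refl
  3^≡1+2*⌊3^/2⌋ (suc j) = begin
    3 * 3 ^ j                  ≡⟨ cong (3 *_) (3^≡1+2*⌊3^/2⌋ j) ⟩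
    3 * suc (h + h)
      ≡⟨ solve 1 (λ h → con 3 :* (con 1 :+ (h :+ h))
                      := con 1 :+ ((con 1 :+ con 3 :* h) :+ (con 1 :+ con 3 :* h))) refl h ⟩
    suc (suc (3 * h) + suc (3 * h)) ∎
    where
    h : ℕ
    h = ⌊3^ j /2⌋

  ⌊3^suc/2⌋≡3^+⌊3^/2⌋ : ∀ j → ⌊3^ suc j /2⌋ ≡ 3 ^ j + ⌊3^ j /2⌋
  ⌊3^suc/2⌋≡3^+⌊3^/2⌋ j rewrite 3^≡1+2*⌊3^/2⌋ j =
    solve 1 (λ h → con 1 :+ con 3 :* h := (con 1 :+ (h :+ h)) :+ h) refl ⌊3^ j /2⌋

  [3^∸1]/2≡⌊3^/2⌋ : ∀ j → (3 ^ j ∸ 1) / 2 ≡ ⌊3^ j /2⌋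
  [3^∸1]/2≡⌊3^/2⌋ j rewrite 3^≡1+2*⌊3^/2⌋ j =
    trans (cong (_/ 2) (solve 1 (λ h → h :+ h := h :* con 2) refl ⌊3^ j /2⌋)) (m*n/n≡m ⌊3^ j /2⌋ 2)

  [3^+3^]/2≡1+⌊3^/2⌋+⌊3^/2⌋ : ∀ j k → (3 ^ j + 3 ^ k) / 2 ≡ suc (⌊3^ j /2⌋ + ⌊3^ k /2⌋)
  [3^+3^]/2≡1+⌊3^/2⌋+⌊3^/2⌋ j k rewrite 3^≡1+2*⌊3^/2⌋ j | 3^≡1+2*⌊3^/2⌋ k =
    trans (cong (_/ 2) (solve 2 (λ a b → (con 1 :+ (a :+ a)) :+ (con 1 :+ (b :+ b)) := (con 1 :+ (a :+ b)) :* con 2)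
                                refl ⌊3^ j /2⌋ ⌊3^ k /2⌋))
          (m*n/n≡m (suc (⌊3^ j /2⌋ + ⌊3^ k /2⌋)) 2)

  2∣⇒2∣⌊3^/2⌋ : ∀ {n} → 2 ∣ n → 2 ∣ ⌊3^ n /2⌋
  2∣⇒2∣⌊3^/2⌋ (divides zero refl)    = divides 0 refl
  2∣⇒2∣⌊3^/2⌋ (divides (suc q) refl) =
    subst (2 ∣_) (solve 1 (λ h → con 4 :+ con 9 :* h := con 1 :+ con 3 :* (con 1 :+ con 3 :* h)) refl ⌊3^ q * 2 /2⌋)
          (∣m∣n⇒∣m+n (divides 2 refl) (∣n⇒∣m*n 9 (2∣⇒2∣⌊3^/2⌋ (divides q refl))))

  C-absorption : ∀ n k → suc k * (suc n C suc k) ≡ suc n * (n C k)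
  C-absorption zero    zero    = refl
  C-absorption zero    (suc k) = *-zeroʳ (suc (suc k))
  C-absorption (suc n) zero    = begin
    1 * (suc (suc n) C 1)  ≡⟨ *-identityˡ _ ⟩
    suc (suc n) C 1        ≡⟨ nC1≡n (suc (suc n)) ⟩
    suc (suc n)            ≡⟨ *-identityʳ _ ⟨
    suc (suc n) * 1        ∎
  C-absorption (suc n) (suc k) = begin
    suc (suc k) * (suc (suc n) C suc (suc k))
      ≡⟨ cong (suc (suc k) *_) (sym (nCk+nC[k+1]≡[n+1]C[k+1] (suc n) (suc k))) ⟩
    suc (suc k) * (a + b)
      ≡⟨ solve 3 (λ k a b → (con 2 :+ k) :* (a :+ b) := ((con 1 :+ k) :* a :+ a) :+ (con 2 :+ k) :* b) refl k a b ⟩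
    (suc k * a + a) + suc (suc k) * b
      ≡⟨ cong₂ (λ u v → u + a + v) (C-absorption n k) (C-absorption n (suc k)) ⟩
    (suc n * (n C k) + a) + suc n * (n C suc k)
      ≡⟨ solve 4 (λ n a c d → ((con 1 :+ n) :* c :+ a) :+ (con 1 :+ n) :* d := a :+ (con 1 :+ n) :* (c :+ d))
                 refl n a (n C k) (n C suc k) ⟩
    a + suc n * (n C k + n C suc k)
      ≡⟨ cong (λ u → a + suc n * u) (nCk+nC[k+1]≡[n+1]C[k+1] n k) ⟩
    suc (suc n) * (suc n C suc k) ∎
    where
    a b : ℕ
    a = suc n C suc k
    b = suc n C suc (suc k)

  dcoeff-numerator : ∀ s j → suc (suc (s + j)) * (suc s C suc j) ≡ (suc s C suc j + s C j) * suc s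
  dcoeff-numerator s j = begin
    suc (suc (s + j)) * B
      ≡⟨ solve 3 (λ s j B → (con 2 :+ (s :+ j)) :* B := (con 1 :+ s) :* B :+ (con 1 :+ j) :* B) refl s j B ⟩
    suc s * B + suc j * B        ≡⟨ cong (suc s * B +_) (C-absorption s j) ⟩
    suc s * B + suc s * (s C j)
      ≡⟨ solve 3 (λ s B c → (con 1 :+ s) :* B :+ (con 1 :+ s) :* c := (B :+ c) :* (con 1 :+ s)) refl s B (s C j) ⟩
    (B + s C j) * suc s          ∎
    where
    B : ℕ
    B = suc s C suc j

  C-pascal-diagonal : ∀ m j → (suc m ∸ j) C suc j ≡ (m ∸ j) C suc j + (m ∸ j) C j
  C-pascal-diagonal m j with j ≤? m
  ... | yes j≤m rewrite +-∸-assoc 1 j≤m =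
    sym (trans (+-comm ((m ∸ j) C suc j) ((m ∸ j) C j)) (nCk+nC[k+1]≡[n+1]C[k+1] (m ∸ j) j))
  ... | no  j≰m with j
  ...   | zero    = ⊥-elim (j≰m z≤n)
  ...   | suc _   rewrite m≤n⇒m∸n≡0 (≰⇒> j≰m) | m≤n⇒m∸n≡0 (<⇒≤ (≰⇒> j≰m)) = refl

  module DicksonCoefficients {c ℓ} (R : CommutativeRing c ℓ) where
    open Poly R using (dcoeff)

    dcoeff-via-∸ : ∀ m i k → m ∸ i ≡ suc k → dcoeff m i ≡ (m * (suc k C i)) / suc k
    dcoeff-via-∸ m i k eq with m ∸ i | eq
    ... | .(suc k) | refl = refl

    dcoeff-zero : ∀ m → dcoeff (suc m) 0 ≡ 1
    dcoeff-zero m = trans (cong (_/ suc m) (*-identityʳ (suc m))) (n/n≡1 (suc m))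

    dcoeff-suc : ∀ {m j} → j ≤ m → dcoeff (suc (suc m)) (suc j) ≡ (suc m ∸ j) C suc j + (m ∸ j) C j
    dcoeff-suc {m} {j} j≤m = begin
      dcoeff (suc (suc m)) (suc j)       ≡⟨ dcoeff-via-∸ (suc (suc m)) (suc j) s 1+m∸j≡1+s ⟩
      (suc (suc m) * B) / suc s          ≡⟨ cong (λ k → (suc (suc k) * B) / suc s) m≡s+j ⟩
      (suc (suc (s + j)) * B) / suc s    ≡⟨ cong (_/ suc s) (dcoeff-numerator s j) ⟩
      ((B + s C j) * suc s) / suc s      ≡⟨ m*n/n≡m _ (suc s) ⟩
      B + s C j                          ≡⟨ cong (λ k → k C suc j + s C j) 1+m∸j≡1+s ⟨
      (suc m ∸ j) C suc j + (m ∸ j) C j  ∎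
      where
      s B : ℕ
      s = m ∸ j
      B = suc s C suc j
      1+m∸j≡1+s : suc m ∸ j ≡ suc s
      1+m∸j≡1+s = +-∸-assoc 1 j≤m
      m≡s+j : m ≡ s + j
      m≡s+j = sym (m∸n+n≡m j≤m)

open Arithmetic

-- With 𝔽₃ as coefficient ring, the ring solver proves identities such as (a + b)³ = a³ + b³ that hold in every
-- commutative ring with 1 + 1 + 1 = 0.
data 𝔽₃ : Set where
  0₃ 1₃ -1₃ : 𝔽₃

_+₃_ : 𝔽₃ → 𝔽₃ → 𝔽₃
0₃  +₃ b   = b
1₃  +₃ 0₃  = 1₃
1₃  +₃ 1₃  = -1₃
1₃  +₃ -1₃ = 0₃
-1₃ +₃ 0₃  = -1₃
-1₃ +₃ 1₃  = 0₃
-1₃ +₃ -1₃ = 1₃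

-₃_ : 𝔽₃ → 𝔽₃
-₃ 0₃  = 0₃
-₃ 1₃  = -1₃
-₃ -1₃ = 1₃

_*₃_ : 𝔽₃ → 𝔽₃ → 𝔽₃
0₃  *₃ b = 0₃
1₃  *₃ b = b
-1₃ *₃ b = -₃ b

𝔽₃-rawRing : RawRing _ _
𝔽₃-rawRing = record
  { _≈_ = _≡_ ; _+_ = _+₃_ ; _*_ = _*₃_ ; -_ = -₃_ ; 0# = 0₃ ; 1# = 1₃ }

module RingProperties {c ℓ} (R : CommutativeRing c ℓ) where

  open CommutativeRing R
  open Poly R
  open import Algebra.Properties.Ring ring using (-1*x≈-x; -‿involutive; [y-z]x≈yx-zx)
  open import Algebra.Properties.Semiring.Exp semiring as Exp using (^-congˡ; ^-homo-*; ^-assocʳ)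
  open import Algebra.Properties.CommutativeSemiring.Exp commutativeSemiring using (^-distrib-*)
  open import Algebra.Properties.Semiring.Mult semiring as Mult using (×-homo-+; ×1-homo-*)
  open import Algebra.Properties.CommutativeSemigroup *-commutativeSemigroup using (interchange; x∙yz≈y∙xz)
  open import Algebra.Properties.CommutativeSemigroup +-commutativeSemigroup using () renaming (interchange to +-interchange)
  open import Relation.Binary.Reasoning.Setoid setoid

  pow≡^ : ∀ x k → pow x k ≡ x Exp.^ k
  pow≡^ x zero    = ≡.refl
  pow≡^ x (suc k) = ≡.cong (x *_) (pow≡^ x k)

  natR≡×1 : ∀ k → natR k ≡ k Mult.× 1#
  natR≡×1 zero    = ≡.refl
  natR≡×1 (suc k) = ≡.cong (1# +_) (natR≡×1 k)

  pow-cong : ∀ k {x y} → x ≈ y → pow x k ≈ pow y k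
  pow-cong k {x} {y} rewrite pow≡^ x k | pow≡^ y k = ^-congˡ k

  pow-+ : ∀ x m n → pow x (m ℕ.+ n) ≈ pow x m * pow x n
  pow-+ x m n rewrite pow≡^ x (m ℕ.+ n) | pow≡^ x m | pow≡^ x n = ^-homo-* x m n

  pow-* : ∀ x m n → pow x (m ℕ.* n) ≈ pow (pow x m) n
  pow-* x m n rewrite pow≡^ x (m ℕ.* n) | pow≡^ x m | pow≡^ (x Exp.^ m) n = sym (^-assocʳ x m n)

  pow-pow-comm : ∀ x m n → pow (pow x m) n ≈ pow (pow x n) m
  pow-pow-comm x m n = begin
    pow (pow x m) n   ≈⟨ pow-* x m n ⟨
    pow x (m ℕ.* n)   ≡⟨ ≡.cong (pow x) (ℕ.*-comm m n) ⟩
    pow x (n ℕ.* m)   ≈⟨ pow-* x n m ⟩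
    pow (pow x n) m   ∎

  pow-distrib-* : ∀ x y n → pow (x * y) n ≈ pow x n * pow y n
  pow-distrib-* x y n rewrite pow≡^ (x * y) n | pow≡^ x n | pow≡^ y n = ^-distrib-* x y n

  pow-1# : ∀ n → pow 1# n ≈ 1#
  pow-1# zero    = refl
  pow-1# (suc n) = trans (*-identityˡ _) (pow-1# n)

  natR-+ : ∀ m n → natR (m ℕ.+ n) ≈ natR m + natR n
  natR-+ m n rewrite natR≡×1 (m ℕ.+ n) | natR≡×1 m | natR≡×1 n = ×-homo-+ 1# m n

  natR-^ : ∀ m n → natR (m ℕ.^ n) ≈ pow (natR m) n
  natR-^ m zero    = +-identityʳ 1#
  natR-^ m (suc n) = begin
    natR (m ℕ.* m ℕ.^ n)          ≡⟨ natR≡×1 (m ℕ.* m ℕ.^ n) ⟩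
    (m ℕ.* m ℕ.^ n) Mult.× 1#     ≈⟨ ×1-homo-* m (m ℕ.^ n) ⟩
    (m Mult.× 1#) * ((m ℕ.^ n) Mult.× 1#)
      ≡⟨ ≡.cong₂ _*_ (≡.sym (natR≡×1 m)) (≡.sym (natR≡×1 (m ℕ.^ n))) ⟩
    natR m * natR (m ℕ.^ n)       ≈⟨ *-congˡ (natR-^ m n) ⟩
    natR m * pow (natR m) n       ∎

  sgn-+ : ∀ m n → sgn (m ℕ.+ n) ≈ sgn m * sgn n
  sgn-+ = pow-+ (- 1#)

  -1*-1≈1 : - 1# * - 1# ≈ 1#
  -1*-1≈1 = trans (-1*x≈-x (- 1#)) (-‿involutive 1#)

  [x-1][x+1]≈x*x-1 : ∀ x → (x - 1#) * (x + 1#) ≈ x * x - 1#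
  [x-1][x+1]≈x*x-1 x = begin
    (x - 1#) * (x + 1#)            ≈⟨ distribˡ (x - 1#) x 1# ⟩
    (x - 1#) * x + (x - 1#) * 1#   ≈⟨ +-cong ([y-z]x≈yx-zx x x 1#) (*-identityʳ _) ⟩
    (x * x - 1# * x) + (x - 1#)    ≈⟨ +-congʳ (+-congˡ (-‿cong (*-identityˡ x))) ⟩
    (x * x - x) + (x - 1#)         ≈⟨ +-assoc _ _ _ ⟩
    x * x + (- x + (x - 1#))       ≈⟨ +-congˡ (+-assoc _ _ _) ⟨
    x * x + ((- x + x) - 1#)       ≈⟨ +-congˡ (+-congʳ (-‿inverseˡ x)) ⟩
    x * x + (0# - 1#)              ≈⟨ +-congˡ (+-identityˡ _) ⟩
    x * x - 1#                     ∎

  sgn-even : ∀ {n} → 2 ∣ n → sgn n ≈ 1#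
  sgn-even (divides k ≡.refl) = begin
    pow (- 1#) (k ℕ.* 2)      ≡⟨ ≡.cong (pow (- 1#)) (ℕ.*-comm k 2) ⟩
    pow (- 1#) (2 ℕ.* k)      ≈⟨ pow-* (- 1#) 2 k ⟩
    pow (- 1# * (- 1# * 1#)) k ≈⟨ pow-cong k (trans (*-congˡ (*-identityʳ _)) -1*-1≈1) ⟩
    pow 1# k                  ≈⟨ pow-1# k ⟩
    1#                        ∎

  sgn-odd : ∀ k → sgn (suc (k ℕ.+ k)) ≈ - 1#
  sgn-odd k = trans (*-congˡ (sgn-even (divides k k+k≡k*2))) (*-identityʳ _)
    where
    k+k≡k*2 : k ℕ.+ k ≡ k ℕ.* 2
    k+k≡k*2 = ≡.trans (≡.cong (k ℕ.+_) (≡.sym (ℕ.+-identityʳ k))) (ℕ.*-comm 2 k)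

  sumTo-cong : ∀ n {g h : ℕ → Carrier} → (∀ i → i < n → g i ≈ h i) → sumTo n g ≈ sumTo n h
  sumTo-cong zero    eq = refl
  sumTo-cong (suc n) eq = +-cong (sumTo-cong n (λ i i<n → eq i (ℕ.m≤n⇒m≤1+n i<n))) (eq n ℕ.≤-refl)

  sumTo-distrib-+ : ∀ n (g h : ℕ → Carrier) → sumTo n (λ i → g i + h i) ≈ sumTo n g + sumTo n h
  sumTo-distrib-+ zero    g h = sym (+-identityˡ 0#)
  sumTo-distrib-+ (suc n) g h = begin
    sumTo n (λ i → g i + h i) + (g n + h n) ≈⟨ +-congʳ (sumTo-distrib-+ n g h) ⟩
    (sumTo n g + sumTo n h) + (g n + h n)   ≈⟨ +-assoc _ _ _ ⟩
    sumTo n g + (sumTo n h + (g n + h n))   ≈⟨ +-congˡ (x+[y+z]≈y+[x+z] _ _ _) ⟩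
    sumTo n g + (g n + (sumTo n h + h n))   ≈⟨ +-assoc _ _ _ ⟨
    (sumTo n g + g n) + (sumTo n h + h n)   ∎
    where
    x+[y+z]≈y+[x+z] : ∀ x y z → x + (y + z) ≈ y + (x + z)
    x+[y+z]≈y+[x+z] x y z = trans (sym (+-assoc x y z)) (trans (+-congʳ (+-comm x y)) (+-assoc y x z))

  sumTo-*ˡ : ∀ n a (g : ℕ → Carrier) → sumTo n (λ i → a * g i) ≈ a * sumTo n g
  sumTo-*ˡ zero    a g = sym (zeroʳ a)
  sumTo-*ˡ (suc n) a g = trans (+-congʳ (sumTo-*ˡ n a g)) (sym (distribˡ a _ _))

  sumTo-suc : ∀ n (g : ℕ → Carrier) → sumTo (suc n) g ≈ g 0 + sumTo n (λ i → g (suc i))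
  sumTo-suc zero    g = trans (+-identityˡ _) (sym (+-identityʳ _))
  sumTo-suc (suc n) g = trans (+-congʳ (sumTo-suc n g)) (+-assoc _ _ _)

  sumTo-zero : ∀ n {g : ℕ → Carrier} → (∀ i → g i ≈ 0#) → sumTo n g ≈ 0#
  sumTo-zero zero    g≈0 = refl
  sumTo-zero (suc n) g≈0 = trans (+-cong (sumTo-zero n g≈0) (g≈0 n)) (+-identityʳ 0#)

  sumTo-product : ∀ m n (g h : ℕ → Carrier) →
                  sumTo m (λ j → sumTo n (λ k → g j * h k)) ≈ sumTo m g * sumTo n h
  sumTo-product m n g h = begin
    sumTo m (λ j → sumTo n (λ k → g j * h k)) ≈⟨ sumTo-cong m (λ j _ → sumTo-*ˡ n (g j) h) ⟩
    sumTo m (λ j → g j * sumTo n h)           ≈⟨ sumTo-cong m (λ j _ → *-comm _ _) ⟩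
    sumTo m (λ j → sumTo n h * g j)           ≈⟨ sumTo-*ˡ m _ g ⟩
    sumTo n h * sumTo m g                     ≈⟨ *-comm _ _ ⟩
    sumTo m g * sumTo n h                     ∎

  sumTo-telescope : ∀ n (a : ℕ → Carrier) → sumTo n (λ j → a j - a (suc j)) ≈ a 0 - a n
  sumTo-telescope zero    a = sym (-‿inverseʳ (a 0))
  sumTo-telescope (suc n) a = begin
    sumTo n (λ j → a j - a (suc j)) + (a n - a (suc n)) ≈⟨ +-congʳ (sumTo-telescope n a) ⟩
    (a 0 - a n) + (a n - a (suc n))   ≈⟨ +-assoc _ _ _ ⟩
    a 0 + (- a n + (a n - a (suc n))) ≈⟨ +-congˡ (sym (+-assoc _ _ _)) ⟩
    a 0 + ((- a n + a n) - a (suc n)) ≈⟨ +-congˡ (+-congʳ (-‿inverseˡ (a n))) ⟩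
    a 0 + (0# - a (suc n))            ≈⟨ +-congˡ (+-identityˡ _) ⟩
    a 0 - a (suc n)                   ∎

  S : ℕ → Carrier → Carrier
  S n y = sumTo n (λ j → sgn j * pow y ⌊3^ j /2⌋)

  S-cong : ∀ n {x y} → x ≈ y → S n x ≈ S n y
  S-cong n x≈y = sumTo-cong n (λ j _ → *-congˡ (pow-cong ⌊3^ j /2⌋ x≈y))

  pow-half : ∀ n x → pow x (half n) ≈ pow x ⌊3^ n /2⌋
  pow-half n x = reflexive (≡.cong (pow x) ([3^∸1]/2≡⌊3^/2⌋ n))

  f-via-⌊3^/2⌋ : ∀ n x → f n x ≈ ((x - pow x 2) - pow x 3) * pow x ⌊3^ n /2⌋ - x + pow x 2
  f-via-⌊3^/2⌋ n x = +-congʳ (+-congʳ (*-congˡ (pow-half n x)))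

  -- (3^j + 3^k)/2 = 1 + (3^j-1)/2 + (3^k-1)/2 makes the double sum y times a square.
  finv-via-S : ∀ n y → finv n y ≈ pow y (3 ℕ.^ (n ∸ 1)) * (pow y ⌊3^ n /2⌋ + 1#)
                                   + y * (S n y * S n y) * (pow y ⌊3^ n /2⌋ - 1#)
  finv-via-S n y =
    +-cong (*-congˡ (+-congʳ (pow-half n y))) (*-cong doubleSum (+-congʳ (pow-half n y)))
    where
    term : ∀ j k → sgn (j ℕ.+ k) * pow y ((3 ℕ.^ j ℕ.+ 3 ℕ.^ k) ℕ./ 2)
                 ≈ y * ((sgn j * pow y ⌊3^ j /2⌋) * (sgn k * pow y ⌊3^ k /2⌋))
    term j k = begin
      sgn (j ℕ.+ k) * pow y ((3 ℕ.^ j ℕ.+ 3 ℕ.^ k) ℕ./ 2)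
        ≈⟨ *-cong (sgn-+ j k) (reflexive (≡.cong (pow y) ([3^+3^]/2≡1+⌊3^/2⌋+⌊3^/2⌋ j k))) ⟩
      (sgn j * sgn k) * (y * pow y (⌊3^ j /2⌋ ℕ.+ ⌊3^ k /2⌋))
        ≈⟨ *-congˡ (*-congˡ (pow-+ y ⌊3^ j /2⌋ ⌊3^ k /2⌋)) ⟩
      (sgn j * sgn k) * (y * (pow y ⌊3^ j /2⌋ * pow y ⌊3^ k /2⌋))
        ≈⟨ trans (x∙yz≈y∙xz _ _ _) (*-congˡ (interchange _ _ _ _)) ⟩
      y * ((sgn j * pow y ⌊3^ j /2⌋) * (sgn k * pow y ⌊3^ k /2⌋)) ∎
    doubleSum : sumTo n (λ j → sumTo n (λ k → sgn (j ℕ.+ k) * pow y ((3 ℕ.^ j ℕ.+ 3 ℕ.^ k) ℕ./ 2)))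
                ≈ y * (S n y * S n y)
    doubleSum = begin
      sumTo n (λ j → sumTo n (λ k → sgn (j ℕ.+ k) * pow y ((3 ℕ.^ j ℕ.+ 3 ℕ.^ k) ℕ./ 2)))
        ≈⟨ sumTo-cong n (λ j _ → sumTo-cong n (λ k _ → term j k)) ⟩
      sumTo n (λ j → sumTo n (λ k → y * ((sgn j * pow y ⌊3^ j /2⌋) * (sgn k * pow y ⌊3^ k /2⌋))))
        ≈⟨ sumTo-cong n (λ j _ → sumTo-*ˡ n y _) ⟩
      sumTo n (λ j → y * sumTo n (λ k → (sgn j * pow y ⌊3^ j /2⌋) * (sgn k * pow y ⌊3^ k /2⌋)))
        ≈⟨ sumTo-*ˡ n y _ ⟩
      y * sumTo n (λ j → sumTo n (λ k → (sgn j * pow y ⌊3^ j /2⌋) * (sgn k * pow y ⌊3^ k /2⌋)))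
        ≈⟨ *-congˡ (sumTo-product n n _ _) ⟩
      y * (S n y * S n y) ∎

  f-cong : ∀ n {x y} → x ≈ y → f n x ≈ f n y
  f-cong n {x} {y} x≈y = +-cong (+-cong (*-cong cubic (pow-cong (half n) x≈y)) (-‿cong x≈y)) (pow-cong 2 x≈y)
    where
    cubic : (x - pow x 2) - pow x 3 ≈ (y - pow y 2) - pow y 3
    cubic = +-cong (+-cong x≈y (-‿cong (pow-cong 2 x≈y))) (-‿cong (pow-cong 3 x≈y))

  finv-cong : ∀ n {x y} → x ≈ y → finv n x ≈ finv n y
  finv-cong n x≈y =
    +-cong (*-cong (pow-cong (3 ℕ.^ (n ∸ 1)) x≈y) (+-congʳ (pow-cong (half n) x≈y)))
           (*-cong (sumTo-cong n (λ j _ → sumTo-cong n (λ k _ →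
                      *-congˡ (pow-cong ((3 ℕ.^ j ℕ.+ 3 ℕ.^ k) ℕ./ 2) x≈y))))
                   (+-congʳ (pow-cong (half n) x≈y)))


  module Fibonacci (x : Carrier) where

    fib : ℕ → Carrier
    fib zero          = 1#
    fib (suc zero)    = 1#
    fib (suc (suc m)) = fib (suc m) + - x * fib m

    signedPow : ℕ → Carrier
    signedPow i = sgn i * pow x i

    signedPow-suc : ∀ i → signedPow (suc i) ≈ - x * signedPow i
    signedPow-suc i = begin
      (- 1# * sgn i) * (x * pow x i)  ≈⟨ interchange _ _ _ _ ⟩
      (- 1# * x) * (sgn i * pow x i)  ≈⟨ *-congʳ (-1*x≈-x x) ⟩
      - x * signedPow i               ∎

    fibSum : ℕ → ℕ → Carrier
    fibSum m N = sumTo N (λ i → natR ((m ∸ i) C i) * signedPow i)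

    sumTo-pascal : ∀ N (a b d : ℕ → ℕ) → (∀ j → j < N → d j ≡ a j ℕ.+ b j) →
                   sumTo N (λ j → natR (d j) * signedPow (suc j))
                   ≈ sumTo N (λ j → natR (a j) * signedPow (suc j))
                     + - x * sumTo N (λ j → natR (b j) * signedPow j)
    sumTo-pascal N a b d d≡a+b = begin
      sumTo N (λ j → natR (d j) * signedPow (suc j))
        ≈⟨ sumTo-cong N split ⟩
      sumTo N (λ j → natR (a j) * signedPow (suc j) + - x * (natR (b j) * signedPow j))
        ≈⟨ sumTo-distrib-+ N _ _ ⟩
      sumTo N (λ j → natR (a j) * signedPow (suc j)) + sumTo N (λ j → - x * (natR (b j) * signedPow j))
        ≈⟨ +-congˡ (sumTo-*ˡ N (- x) _) ⟩
      sumTo N (λ j → natR (a j) * signedPow (suc j)) + - x * sumTo N (λ j → natR (b j) * signedPow j)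
        ∎
      where
      split : ∀ j → j < N →
              natR (d j) * signedPow (suc j) ≈ natR (a j) * signedPow (suc j) + - x * (natR (b j) * signedPow j)
      split j j<N = begin
        natR (d j) * signedPow (suc j)
          ≡⟨ ≡.cong (λ k → natR k * signedPow (suc j)) (d≡a+b j j<N) ⟩
        natR (a j ℕ.+ b j) * signedPow (suc j)
          ≈⟨ *-congʳ (natR-+ (a j) (b j)) ⟩
        (natR (a j) + natR (b j)) * signedPow (suc j)
          ≈⟨ distribʳ _ _ _ ⟩
        natR (a j) * signedPow (suc j) + natR (b j) * signedPow (suc j)
          ≈⟨ +-congˡ (*-congˡ (signedPow-suc j)) ⟩
        natR (a j) * signedPow (suc j) + natR (b j) * (- x * signedPow j)
          ≈⟨ +-congˡ (x∙yz≈y∙xz _ _ _) ⟩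
        natR (a j) * signedPow (suc j) + - x * (natR (b j) * signedPow j)
          ∎

    fibSum-step : ∀ m N → fibSum (suc (suc m)) (suc N) ≈ fibSum (suc m) (suc N) + - x * fibSum m N
    fibSum-step m N = begin
      fibSum (suc (suc m)) (suc N)
        ≈⟨ sumTo-suc N _ ⟩
      head + sumTo N (λ j → natR ((suc m ∸ j) C suc j) * signedPow (suc j))
        ≈⟨ +-congˡ (sumTo-pascal N (λ j → (m ∸ j) C suc j) (λ j → (m ∸ j) C j) _
                                 (λ j _ → C-pascal-diagonal m j)) ⟩
      head + (sumTo N (λ j → natR ((m ∸ j) C suc j) * signedPow (suc j)) + - x * fibSum m N)
        ≈⟨ +-assoc _ _ _ ⟨
      (head + sumTo N (λ j → natR ((m ∸ j) C suc j) * signedPow (suc j))) + - x * fibSum m N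
        ≈⟨ +-congʳ (sumTo-suc N _) ⟨
      fibSum (suc m) (suc N) + - x * fibSum m N ∎
      where
      head : Carrier
      head = natR 1 * signedPow 0

    fibSum-≤1 : ∀ m N → m ≤ 1 → fibSum m (suc N) ≈ 1#
    fibSum-≤1 m N m≤1 = begin
      fibSum m (suc N)
        ≈⟨ sumTo-suc N _ ⟩
      natR 1 * signedPow 0 + sumTo N (λ j → natR ((m ∸ suc j) C suc j) * signedPow (suc j))
        ≈⟨ +-cong (*-cong (+-identityʳ 1#) (*-identityʳ 1#)) (sumTo-zero N vanish) ⟩
      1# * 1# + 0#  ≈⟨ +-identityʳ _ ⟩
      1# * 1#       ≈⟨ *-identityʳ 1# ⟩
      1#            ∎
      where
      vanish : ∀ j → natR ((m ∸ suc j) C suc j) * signedPow (suc j) ≈ 0#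
      vanish j = begin
        natR ((m ∸ suc j) C suc j) * signedPow (suc j)
          ≡⟨ ≡.cong (λ k → natR (k C suc j) * signedPow (suc j))
                    (ℕ.m≤n⇒m∸n≡0 (ℕ.≤-trans m≤1 (ℕ.s≤s (ℕ.z≤n {j})))) ⟩
        0# * signedPow (suc j)  ≈⟨ zeroˡ _ ⟩
        0#                      ∎

    fibSum≈fib : ∀ m N → m ℕ./ 2 < N → fibSum m N ≈ fib m
    fibSum≈fib zero          (suc N) _ = fibSum-≤1 0 N ℕ.z≤n
    fibSum≈fib (suc zero)    (suc N) _ = fibSum-≤1 1 N ℕ.≤-refl
    fibSum≈fib (suc (suc m)) (suc N) [2+m]/2<1+N = begin
      fibSum (suc (suc m)) (suc N)               ≈⟨ fibSum-step m N ⟩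
      fibSum (suc m) (suc N) + - x * fibSum m N
        ≈⟨ +-cong (fibSum≈fib (suc m) (suc N) [1+m]/2<1+N) (*-congˡ (fibSum≈fib m N m/2<N)) ⟩
      fib (suc m) + - x * fib m                  ∎
      where
      [2+m]/2≡1+m/2 : suc (suc m) ℕ./ 2 ≡ suc (m ℕ./ 2)
      [2+m]/2≡1+m/2 = m/n≡1+[m∸n]/n {suc (suc m)} {2} (ℕ.s≤s (ℕ.s≤s ℕ.z≤n))
      m/2<N : m ℕ./ 2 < N
      m/2<N = ℕ.≤-pred (≡.subst (_< suc N) [2+m]/2≡1+m/2 [2+m]/2<1+N)
      [1+m]/2<1+N : suc m ℕ./ 2 < suc N
      [1+m]/2<1+N = ℕ.≤-<-trans (/-monoˡ-≤ 2 (ℕ.n≤1+n (suc m))) [2+m]/2<1+N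

    revDickson≈fib : ∀ m → revDickson (suc (suc m)) 1# x ≈ fib (suc (suc m)) + - x * fib m
    revDickson≈fib m = begin
      revDickson (suc (suc m)) 1# x
        ≡⟨ ≡.cong (λ k → sumTo (suc k) term) [2+m]/2≡1+H ⟩
      sumTo (suc (suc H)) term
        ≈⟨ sumTo-cong (suc (suc H)) (λ i _ → term≈ i) ⟩
      sumTo (suc (suc H)) (λ i → natR (dcoeff (suc (suc m)) i) * signedPow i)
        ≈⟨ sumTo-suc (suc H) _ ⟩
      natR (dcoeff (suc (suc m)) 0) * signedPow 0
        + sumTo (suc H) (λ j → natR (dcoeff (suc (suc m)) (suc j)) * signedPow (suc j))
        ≈⟨ +-cong (reflexive (≡.cong (λ k → natR k * signedPow 0) (dcoeff-zero (suc m))))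
                  (sumTo-pascal (suc H) (λ j → (suc m ∸ j) C suc j) (λ j → (m ∸ j) C j) _
                     (λ j j<1+H → dcoeff-suc (ℕ.≤-trans (ℕ.≤-pred j<1+H) (m/n≤m m 2)))) ⟩
      natR 1 * signedPow 0
        + (sumTo (suc H) (λ j → natR ((suc m ∸ j) C suc j) * signedPow (suc j)) + - x * fibSum m (suc H))
        ≈⟨ +-assoc _ _ _ ⟨
      (natR 1 * signedPow 0 + sumTo (suc H) (λ j → natR ((suc m ∸ j) C suc j) * signedPow (suc j)))
        + - x * fibSum m (suc H)
        ≈⟨ +-congʳ (sumTo-suc (suc H) _) ⟨
      fibSum (suc (suc m)) (suc (suc H)) + - x * fibSum m (suc H)
        ≈⟨ +-cong (fibSum≈fib (suc (suc m)) (suc (suc H)) (ℕ.≤-reflexive (≡.cong suc [2+m]/2≡1+H)))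
                  (*-congˡ (fibSum≈fib m (suc H) ℕ.≤-refl)) ⟩
      fib (suc (suc m)) + - x * fib m ∎
      where
      open DicksonCoefficients R using (dcoeff-zero; dcoeff-suc)
      H : ℕ
      H = m ℕ./ 2
      [2+m]/2≡1+H : suc (suc m) ℕ./ 2 ≡ suc H
      [2+m]/2≡1+H = m/n≡1+[m∸n]/n {suc (suc m)} {2} (ℕ.s≤s (ℕ.s≤s ℕ.z≤n))
      term : ℕ → Carrier
      term i = natR (dcoeff (suc (suc m)) i) * sgn i * pow 1# (suc (suc m) ∸ 2 ℕ.* i) * pow x i
      term≈ : ∀ i → term i ≈ natR (dcoeff (suc (suc m)) i) * signedPow i
      term≈ i = begin
        term i
          ≈⟨ *-congʳ (*-congˡ (pow-1# (suc (suc m) ∸ 2 ℕ.* i))) ⟩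
        natR (dcoeff (suc (suc m)) i) * sgn i * 1# * pow x i  ≈⟨ *-congʳ (*-identityʳ _) ⟩
        natR (dcoeff (suc (suc m)) i) * sgn i * pow x i       ≈⟨ *-assoc _ _ _ ⟩
        natR (dcoeff (suc (suc m)) i) * signedPow i           ∎

    Recurrent : (ℕ → Carrier) → Set ℓ
    Recurrent a = ∀ k → a (suc (suc k)) ≈ a (suc k) + - x * a k

    recurrent-unique : ∀ {a b} → Recurrent a → Recurrent b → a 0 ≈ b 0 → a 1 ≈ b 1 → ∀ k → a k ≈ b k
    recurrent-unique ra rb a₀≈b₀ a₁≈b₁ zero                  = a₀≈b₀
    recurrent-unique ra rb a₀≈b₀ a₁≈b₁ (suc zero)            = a₁≈b₁
    recurrent-unique {a} {b} ra rb a₀≈b₀ a₁≈b₁ (suc (suc k)) =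
      trans (ra k) (trans (+-cong (a≈b (suc k)) (*-congˡ (a≈b k))) (sym (rb k)))
      where
      a≈b : ∀ k → a k ≈ b k
      a≈b = recurrent-unique ra rb a₀≈b₀ a₁≈b₁

    recurrent-combine : ∀ t {a b} → Recurrent a → Recurrent b → Recurrent (λ k → a k + t * b k)
    recurrent-combine t {a} {b} ra rb k = begin
      a (suc (suc k)) + t * b (suc (suc k))
        ≈⟨ +-cong (ra k) (*-congˡ (rb k)) ⟩
      (a (suc k) + - x * a k) + t * (b (suc k) + - x * b k)
        ≈⟨ +-congˡ (distribˡ t _ _) ⟩
      (a (suc k) + - x * a k) + (t * b (suc k) + t * (- x * b k))
        ≈⟨ +-interchange _ _ _ _ ⟩
      (a (suc k) + t * b (suc k)) + (- x * a k + t * (- x * b k))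
        ≈⟨ +-congˡ (+-congˡ (x∙yz≈y∙xz t (- x) (b k))) ⟩
      (a (suc k) + t * b (suc k)) + (- x * a k + - x * (t * b k))
        ≈⟨ +-congˡ (distribˡ (- x) _ _) ⟨
      (a (suc k) + t * b (suc k)) + - x * (a k + t * b k) ∎

    revDickson-recurrent : Recurrent (λ k → fib (suc (suc k)) + - x * fib k)
    revDickson-recurrent = recurrent-combine (- x) (λ _ → refl) (λ _ → refl)

Characteristic3 : ∀ {c ℓ} → CommutativeRing c ℓ → Set ℓ
Characteristic3 R = 1# + 1# + 1# ≈ 0#
  where open CommutativeRing R

module CharacteristicThree {c ℓ} (R : CommutativeRing c ℓ) (char3 : Characteristic3 R) where

  open CommutativeRing R
  open Poly R
  open RingProperties R
  open import Algebra.Properties.Ring ring using (-‿+-comm; -‿involutive; -0#≈0#)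
  open import Relation.Binary.Reasoning.Setoid setoid

  1+1≈-1 : 1# + 1# ≈ - 1#
  1+1≈-1 = begin
    1# + 1#               ≈⟨ +-identityʳ _ ⟨
    (1# + 1#) + 0#        ≈⟨ +-congˡ (-‿inverseʳ 1#) ⟨
    (1# + 1#) + (1# - 1#) ≈⟨ +-assoc _ _ _ ⟨
    (1# + 1# + 1#) - 1#   ≈⟨ +-congʳ char3 ⟩
    0# - 1#               ≈⟨ +-identityˡ _ ⟩
    - 1#                  ∎

  ⟦_⟧₃ : 𝔽₃ → Carrier
  ⟦ 0₃ ⟧₃  = 0#
  ⟦ 1₃ ⟧₃  = 1#
  ⟦ -1₃ ⟧₃ = - 1#

  -1+-1≈1 : - 1# + - 1# ≈ 1#
  -1+-1≈1 = begin
    - 1# + - 1#  ≈⟨ -‿+-comm 1# 1# ⟩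
    - (1# + 1#)  ≈⟨ -‿cong 1+1≈-1 ⟩
    - - 1#       ≈⟨ -‿involutive 1# ⟩
    1#           ∎

  +-homo : ∀ a b → ⟦ a +₃ b ⟧₃ ≈ ⟦ a ⟧₃ + ⟦ b ⟧₃
  +-homo 0₃  b   = sym (+-identityˡ _)
  +-homo 1₃  0₃  = sym (+-identityʳ _)
  +-homo 1₃  1₃  = sym 1+1≈-1
  +-homo 1₃  -1₃ = sym (-‿inverseʳ 1#)
  +-homo -1₃ 0₃  = sym (+-identityʳ _)
  +-homo -1₃ 1₃  = sym (-‿inverseˡ 1#)
  +-homo -1₃ -1₃ = sym -1+-1≈1

  *-homo : ∀ a b → ⟦ a *₃ b ⟧₃ ≈ ⟦ a ⟧₃ * ⟦ b ⟧₃
  *-homo 0₃  b   = sym (zeroˡ _)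
  *-homo 1₃  b   = sym (*-identityˡ _)
  *-homo -1₃ 0₃  = sym (zeroʳ _)
  *-homo -1₃ 1₃  = sym (*-identityʳ _)
  *-homo -1₃ -1₃ = sym -1*-1≈1

  -‿homo : ∀ a → ⟦ -₃ a ⟧₃ ≈ - ⟦ a ⟧₃
  -‿homo 0₃  = sym -0#≈0#
  -‿homo 1₃  = refl
  -‿homo -1₃ = sym (-‿involutive 1#)

  homomorphism : 𝔽₃-rawRing -Raw-AlmostCommutative⟶ fromCommutativeRing R
  homomorphism = record
    { ⟦_⟧ = ⟦_⟧₃ ; +-homo = +-homo ; *-homo = *-homo ; -‿homo = -‿homo
    ; 0-homo = refl ; 1-homo = refl }

  _≟₃_ : ∀ a b → Maybe (⟦ a ⟧₃ ≈ ⟦ b ⟧₃)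
  0₃  ≟₃ 0₃  = just refl
  1₃  ≟₃ 1₃  = just refl
  -1₃ ≟₃ -1₃ = just refl
  _   ≟₃ _   = nothing

  open import Algebra.Solver.Ring 𝔽₃-rawRing (fromCommutativeRing R) homomorphism _≟₃_ public

  cube-+ : ∀ a b → pow (a + b) 3 ≈ pow a 3 + pow b 3
  cube-+ = solve 2 (λ a b → (a :+ b) :^ 3 := a :^ 3 :+ b :^ 3) refl

  pow-3^suc : ∀ x j → pow x (3 ℕ.^ suc j) ≈ pow (pow x (3 ℕ.^ j)) 3
  pow-3^suc x j = trans (reflexive (≡.cong (pow x) (ℕ.*-comm 3 (3 ℕ.^ j)))) (pow-* x (3 ℕ.^ j) 3)

  frobenius : ∀ j a b → pow (a + b) (3 ℕ.^ j) ≈ pow a (3 ℕ.^ j) + pow b (3 ℕ.^ j)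
  frobenius zero    a b = trans (*-identityʳ _) (sym (+-cong (*-identityʳ a) (*-identityʳ b)))
  frobenius (suc j) a b = begin
    pow (a + b) (3 ℕ.^ suc j)                        ≈⟨ pow-3^suc (a + b) j ⟩
    pow (pow (a + b) (3 ℕ.^ j)) 3                    ≈⟨ pow-cong 3 (frobenius j a b) ⟩
    pow (pow a (3 ℕ.^ j) + pow b (3 ℕ.^ j)) 3        ≈⟨ cube-+ _ _ ⟩
    pow (pow a (3 ℕ.^ j)) 3 + pow (pow b (3 ℕ.^ j)) 3 ≈⟨ +-cong (pow-3^suc a j) (pow-3^suc b j) ⟨
    pow a (3 ℕ.^ suc j) + pow b (3 ℕ.^ suc j)        ∎

  -- (x + 1)^(3^j) = x^(3^j) + 1 turns each term of (x + 1) S into a difference.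
  S-telescope : ∀ n x → (x + 1#) * S n (x * ((x + 1#) * (x + 1#))) ≈ 1# - sgn n * pow x ⌊3^ n /2⌋
  S-telescope n x = begin
    (x + 1#) * S n y                                  ≈⟨ sumTo-*ˡ n (x + 1#) _ ⟨
    sumTo n (λ j → (x + 1#) * (sgn j * pow y ⌊3^ j /2⌋)) ≈⟨ sumTo-cong n (λ j _ → term j) ⟩
    sumTo n (λ j → a j - a (suc j))                   ≈⟨ sumTo-telescope n a ⟩
    1# * 1# - a n                                     ≈⟨ +-congʳ (*-identityʳ 1#) ⟩
    1# - a n                                          ∎
    where
    t : Carrier
    t = x + 1#
    y : Carrier
    y = x * (t * t)
    a : ℕ → Carrier
    a j = sgn j * pow x ⌊3^ j /2⌋
    term : ∀ j → t * (sgn j * pow y ⌊3^ j /2⌋) ≈ a j - a (suc j)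
    term j = begin
      t * (s * pow y h)                     ≈⟨ *-congˡ (*-congˡ (pow-distrib-* x (t * t) h)) ⟩
      t * (s * (p * pow (t * t) h))
        ≈⟨ *-congˡ (*-congˡ (*-congˡ (trans (pow-distrib-* t t h) (sym (pow-+ t h h))))) ⟩
      t * (s * (p * pow t (h ℕ.+ h)))
        ≈⟨ solve 4 (λ t s p q → t :* (s :* (p :* q)) := s :* (p :* (t :* q))) refl t s p (pow t (h ℕ.+ h)) ⟩
      s * (p * pow t (suc (h ℕ.+ h)))        ≡⟨ ≡.cong (λ k → s * (p * pow t k)) (3^≡1+2*⌊3^/2⌋ j) ⟨
      s * (p * pow t (3 ℕ.^ j))
        ≈⟨ *-congˡ (*-congˡ (trans (frobenius j x 1#) (+-congˡ (pow-1# (3 ℕ.^ j))))) ⟩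
      s * (p * (pow x (3 ℕ.^ j) + 1#))
        ≈⟨ solve 3 (λ s p X → s :* (p :* (X :+ con 1₃)) := s :* p :- ((:- con 1₃) :* s) :* (X :* p))
                   refl s p (pow x (3 ℕ.^ j)) ⟩
      a j - sgn (suc j) * (pow x (3 ℕ.^ j) * p)
        ≈⟨ +-congˡ (-‿cong (*-congˡ (trans (sym (pow-+ x (3 ℕ.^ j) h))
                                           (reflexive (≡.cong (pow x) (≡.sym (⌊3^suc/2⌋≡3^+⌊3^/2⌋ j))))))) ⟩
      a j - a (suc j)                        ∎
      where
      s : Carrier
      s = sgn j
      h : ℕ
      h = ⌊3^ j /2⌋
      p : Carrier
      p = pow x h

module QuadraticExtension {c ℓ} (R : CommutativeRing c ℓ) (char3 : Characteristic3 R)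
  (Δ : CommutativeRing.Carrier R) where

  open CommutativeRing R
  open Poly R
  open RingProperties R
  open CharacteristicThree R char3
  open import Relation.Binary.Reasoning.Setoid (×-setoid setoid setoid)
  open Setoid (×-setoid setoid setoid) public using () renaming (_≈_ to _≈₂_; refl to ≈₂-refl; sym to ≈₂-sym)

  infixl 7 _⊙_
  infixr 8 _⊙^_

  -- (a , b) stands for a + b √Δ
  _⊙_ : Carrier × Carrier → Carrier × Carrier → Carrier × Carrier
  (a , b) ⊙ (c , d) = (a * c + Δ * (b * d) , a * d + b * c)

  _⊙^_ : Carrier × Carrier → ℕ → Carrier × Carrier
  p ⊙^ zero  = (1# , 0#)
  p ⊙^ suc k = p ⊙ p ⊙^ k

  -- _⊙_ and _⊙^_ mirrored on solver expressions, so that identities between pairs can be handed to solve.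
  mulₑ : ∀ {k} → Polynomial k → Polynomial k × Polynomial k → Polynomial k × Polynomial k →
         Polynomial k × Polynomial k
  mulₑ D (a , b) (c , d) = (a :* c :+ D :* (b :* d) , a :* d :+ b :* c)

  powₑ : ∀ {k} → Polynomial k → Polynomial k × Polynomial k → ℕ → Polynomial k × Polynomial k
  powₑ D p zero    = (con 1₃ , con 0₃)
  powₑ D p (suc k) = mulₑ D p (powₑ D p k)

  ⊙-cong : ∀ {p p′ q q′} → p ≈₂ p′ → q ≈₂ q′ → p ⊙ q ≈₂ p′ ⊙ q′
  ⊙-cong (a≈ , b≈) (c≈ , d≈) =
    +-cong (*-cong a≈ c≈) (*-congˡ (*-cong b≈ d≈)) , +-cong (*-cong a≈ d≈) (*-cong b≈ c≈)

  ⊙-assoc : ∀ p q r → (p ⊙ q) ⊙ r ≈₂ p ⊙ (q ⊙ r)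
  ⊙-assoc (a , b) (c , d) (e , f) =
    solve 7 (λ D a b c d e f → proj₁ (mulₑ D (mulₑ D (a , b) (c , d)) (e , f))
                            := proj₁ (mulₑ D (a , b) (mulₑ D (c , d) (e , f)))) refl Δ a b c d e f ,
    solve 7 (λ D a b c d e f → proj₂ (mulₑ D (mulₑ D (a , b) (c , d)) (e , f))
                            := proj₂ (mulₑ D (a , b) (mulₑ D (c , d) (e , f)))) refl Δ a b c d e f

  ⊙-identityˡ : ∀ p → (1# , 0#) ⊙ p ≈₂ p
  ⊙-identityˡ (a , b) =
    solve 3 (λ D a b → proj₁ (mulₑ D (con 1₃ , con 0₃) (a , b)) := a) refl Δ a b ,
    solve 3 (λ D a b → proj₂ (mulₑ D (con 1₃ , con 0₃) (a , b)) := b) refl Δ a b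

  ⊙^-+ : ∀ p m n → p ⊙^ (m ℕ.+ n) ≈₂ p ⊙^ m ⊙ p ⊙^ n
  ⊙^-+ p zero    n = ≈₂-sym (⊙-identityˡ (p ⊙^ n))
  ⊙^-+ p (suc m) n = begin
    p ⊙ p ⊙^ (m ℕ.+ n)      ≈⟨ ⊙-cong ≈₂-refl (⊙^-+ p m n) ⟩
    p ⊙ (p ⊙^ m ⊙ p ⊙^ n)   ≈⟨ ⊙-assoc p _ _ ⟨
    p ⊙ p ⊙^ m ⊙ p ⊙^ n     ∎

  ⊙^-3* : ∀ p k → p ⊙^ (3 ℕ.* k) ≈₂ (p ⊙^ k) ⊙^ 3
  ⊙^-3* p k = begin
    p ⊙^ (k ℕ.+ (k ℕ.+ (k ℕ.+ 0)))           ≈⟨ ⊙^-+ p k _ ⟩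
    p ⊙^ k ⊙ p ⊙^ (k ℕ.+ (k ℕ.+ 0))          ≈⟨ ⊙-cong ≈₂-refl (⊙^-+ p k _) ⟩
    p ⊙^ k ⊙ (p ⊙^ k ⊙ p ⊙^ (k ℕ.+ 0))       ≈⟨ ⊙-cong ≈₂-refl (⊙-cong ≈₂-refl (⊙^-+ p k 0)) ⟩
    p ⊙^ k ⊙ (p ⊙^ k ⊙ (p ⊙^ k ⊙ (1# , 0#))) ∎

  ⊙^3 : ∀ a b → (a , b) ⊙^ 3 ≈₂ (pow a 3 , Δ * pow b 3)
  ⊙^3 a b =
    solve 3 (λ D a b → proj₁ (powₑ D (a , b) 3) := a :^ 3) refl Δ a b ,
    solve 3 (λ D a b → proj₂ (powₑ D (a , b) 3) := D :* b :^ 3) refl Δ a b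

  ⊙^-congˡ : ∀ k {p q} → p ≈₂ q → p ⊙^ k ≈₂ q ⊙^ k
  ⊙^-congˡ zero    p≈q = ≈₂-refl
  ⊙^-congˡ (suc k) p≈q = ⊙-cong p≈q (⊙^-congˡ k p≈q)

  u : Carrier × Carrier
  u = (- 1# , - 1#)

  u⊙^3^ : ∀ j → u ⊙^ (3 ℕ.^ j) ≈₂ (- 1# , - pow Δ ⌊3^ j /2⌋)
  u⊙^3^ zero =
    solve 1 (λ D → proj₁ (mulₑ D (:- con 1₃ , :- con 1₃) (con 1₃ , con 0₃)) := :- con 1₃) refl Δ ,
    solve 1 (λ D → proj₂ (mulₑ D (:- con 1₃ , :- con 1₃) (con 1₃ , con 0₃)) := :- con 1₃) refl Δ
  u⊙^3^ (suc j) = begin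
    u ⊙^ (3 ℕ.* 3 ℕ.^ j)           ≈⟨ ⊙^-3* u (3 ℕ.^ j) ⟩
    (u ⊙^ 3 ℕ.^ j) ⊙^ 3            ≈⟨ ⊙^-congˡ 3 (u⊙^3^ j) ⟩
    (- 1# , - e) ⊙^ 3               ≈⟨ ⊙^3 (- 1#) (- e) ⟩
    (pow (- 1#) 3 , Δ * pow (- e) 3)
      ≈⟨ solve 0 ((:- con 1₃) :^ 3 := :- con 1₃) refl ,
         trans (solve 2 (λ D e → D :* (:- e) :^ 3 := :- (D :* e :^ 3)) refl Δ e) (-‿cong Δe³≈) ⟩
    (- 1# , - pow Δ ⌊3^ suc j /2⌋)  ∎
    where
    e : Carrier
    e = pow Δ ⌊3^ j /2⌋
    Δe³≈ : Δ * pow e 3 ≈ pow Δ ⌊3^ suc j /2⌋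
    Δe³≈ = *-congˡ (trans (sym (pow-* Δ ⌊3^ j /2⌋ 3)) (reflexive (≡.cong (pow Δ) (ℕ.*-comm ⌊3^ j /2⌋ 3))))

module ReversedDicksonCharacteristicThree {c ℓ} (R : CommutativeRing c ℓ) (char3 : Characteristic3 R)
  (x : CommutativeRing.Carrier R) where

  open CommutativeRing R
  open Poly R
  open RingProperties R
  open Fibonacci x
  open CharacteristicThree R char3
  open QuadraticExtension R char3 (1# - x)
  open import Relation.Binary.Reasoning.Setoid setoid

  -- D_k(1,x) = αᵏ + βᵏ for the roots α, β of T² - T + x. In characteristic 3 these are -(1 ± √(1 - x)),
  -- so D_k(1,x) = 2 Re uᵏ = - Re uᵏ with u = -(1 + √(1 - x)).
  lucas : ℕ → Carrier
  lucas k = - proj₁ (u ⊙^ k)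

  lucas-recurrent : Recurrent lucas
  lucas-recurrent k = solve 3
    (λ X a b → let D = con 1₃ :- X ; uₑ = (:- con 1₃ , :- con 1₃) in
       :- proj₁ (mulₑ D uₑ (mulₑ D uₑ (a , b))) := :- proj₁ (mulₑ D uₑ (a , b)) :+ (:- X) :* (:- a))
    refl x (proj₁ (u ⊙^ k)) (proj₂ (u ⊙^ k))

  revDickson≈lucas : ∀ m → revDickson (suc (suc m)) 1# x ≈ lucas (suc (suc m))
  revDickson≈lucas m = trans (revDickson≈fib m)
    (recurrent-unique revDickson-recurrent (λ k → lucas-recurrent (suc (suc k))) lucas₂ lucas₃ m)
    where
    lucas₂ : fib 2 + - x * fib 0 ≈ lucas 2
    lucas₂ = solve 1 (λ X → ((con 1₃ :+ (:- X) :* con 1₃) :+ (:- X) :* con 1₃)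
                           := :- proj₁ (powₑ (con 1₃ :- X) (:- con 1₃ , :- con 1₃) 2)) refl x
    lucas₃ : fib 3 + - x * fib 1 ≈ lucas 3
    lucas₃ = solve 1 (λ X → (((con 1₃ :+ (:- X) :* con 1₃) :+ (:- X) :* con 1₃) :+ (:- X) :* con 1₃)
                           := :- proj₁ (powₑ (con 1₃ :- X) (:- con 1₃ , :- con 1₃) 3)) refl x

  revDickson≈f : ∀ n → revDickson (3 ℕ.^ n ℕ.+ 5) 1# x ≈ f n (1# - x) - 1#
  revDickson≈f n = begin
    revDickson (3 ℕ.^ n ℕ.+ 5) 1# x         ≡⟨ ≡.cong (λ k → revDickson k 1# x) 3^n+5≡2+[3^n+3] ⟩
    revDickson (suc (suc (3 ℕ.^ n ℕ.+ 3))) 1# x ≈⟨ revDickson≈lucas (3 ℕ.^ n ℕ.+ 3) ⟩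
    lucas (suc (suc (3 ℕ.^ n ℕ.+ 3)))        ≡⟨ ≡.cong lucas 3^n+5≡2+[3^n+3] ⟨
    - proj₁ (u ⊙^ (3 ℕ.^ n ℕ.+ 5))           ≈⟨ -‿cong (proj₁ (⊙^-+ u (3 ℕ.^ n) 5)) ⟩
    - proj₁ (u ⊙^ 3 ℕ.^ n ⊙ u ⊙^ 5)          ≈⟨ -‿cong (proj₁ (⊙-cong (u⊙^3^ n) ≈₂-refl)) ⟩
    - proj₁ ((- 1# , - e) ⊙ u ⊙^ 5)
      ≈⟨ solve 2 (λ X E → let Δₑ = con 1₃ :- X in
           :- proj₁ (mulₑ Δₑ (:- con 1₃ , :- E) (powₑ Δₑ (:- con 1₃ , :- con 1₃) 5))
           := ((Δₑ :- Δₑ :^ 2) :- Δₑ :^ 3) :* E :- Δₑ :+ Δₑ :^ 2 :- con 1₃) refl x e ⟩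
    ((Δ - pow Δ 2) - pow Δ 3) * e - Δ + pow Δ 2 - 1# ≈⟨ +-congʳ (f-via-⌊3^/2⌋ n Δ) ⟨
    f n Δ - 1#                               ∎
    where
    Δ e : Carrier
    Δ = 1# - x
    e = pow Δ ⌊3^ n /2⌋
    3^n+5≡2+[3^n+3] : 3 ℕ.^ n ℕ.+ 5 ≡ suc (suc (3 ℕ.^ n ℕ.+ 3))
    3^n+5≡2+[3^n+3] = ≡.trans (ℕ.+-suc (3 ℕ.^ n) 4) (≡.cong suc (ℕ.+-suc (3 ℕ.^ n) 3))

Fin-injective⇒surjective : ∀ {n} (h : Fin n → Fin n) → Injective _≡_ _≡_ h → ∀ j → ∃ λ i → h i ≡ j
Fin-injective⇒surjective {suc n} h h-inj j with Fin.any? (λ i → h i Fin.≟ j)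
... | yes hit = hit
... | no  miss = ⊥-elim (ℕ.<-irrefl ≡.refl (Fin.injective⇒≤ h′-inj))
  where
  j≢h : ∀ i → j ≢ h i
  j≢h i j≡hi = miss (i , ≡.sym j≡hi)
  h′ : Fin (suc n) → Fin n
  h′ i = Fin.punchOut (j≢h i)
  h′-inj : Injective _≡_ _≡_ h′
  h′-inj {a} {b} eq = h-inj (Fin.punchOut-injective (j≢h a) (j≢h b) eq)

module FiniteFieldProperties {q c ℓ} (F : FiniteField q c ℓ) where

  open FiniteField F
  open CommutativeRing cring hiding (zero)
  open Poly cring
  open RingProperties cring
  open import Algebra.Properties.Ring ring using (x∙y⁻¹≈ε⇒x≈y; +-inverseˡ-unique; +-identityˡ-unique)
  open import Relation.Binary.Reasoning.Setoid setoid
  open Inverse card using (to-cong; from-cong; strictlyInverseˡ; strictlyInverseʳ)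
    renaming (to to index; from to element)
  module Σ = CommutativeMonoidSum +-commutativeMonoid
  module Π = CommutativeMonoidSum *-commutativeMonoid

  index-injective : ∀ {x y} → index x ≡ index y → x ≈ y
  index-injective {x} {y} eq = trans (sym (strictlyInverseʳ x)) (trans (from-cong eq) (strictlyInverseʳ y))

  _≟_ : Decidable _≈_
  x ≟ y with index x Fin.≟ index y
  ... | yes eq = yes (index-injective eq)
  ... | no  ne = no (λ x≈y → ne (to-cong x≈y))

  x*y≈0⇒x≈0⊎y≈0 : ∀ {x y} → x * y ≈ 0# → x ≈ 0# ⊎ y ≈ 0#
  x*y≈0⇒x≈0⊎y≈0 {x} {y} xy≈0 with x ≟ 0#
  ... | yes x≈0 = inj₁ x≈0
  ... | no  x≉0 with inverse x x≉0
  ...   | x⁻¹ , xx⁻¹≈1 = inj₂ (begin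
    y               ≈⟨ *-identityˡ y ⟨
    1# * y          ≈⟨ *-congʳ (trans (sym xx⁻¹≈1) (*-comm x x⁻¹)) ⟩
    (x⁻¹ * x) * y   ≈⟨ *-assoc _ _ _ ⟩
    x⁻¹ * (x * y)   ≈⟨ *-congˡ xy≈0 ⟩
    x⁻¹ * 0#        ≈⟨ zeroʳ x⁻¹ ⟩
    0#              ∎)

  *-nonzero : ∀ {x y} → ¬ x ≈ 0# → ¬ y ≈ 0# → ¬ x * y ≈ 0#
  *-nonzero x≉0 y≉0 xy≈0 with x*y≈0⇒x≈0⊎y≈0 xy≈0
  ... | inj₁ x≈0 = x≉0 x≈0
  ... | inj₂ y≈0 = y≉0 y≈0

  pow≈0⇒≈0 : ∀ x k → pow x k ≈ 0# → x ≈ 0#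
  pow≈0⇒≈0 x zero    1≈0 = ⊥-elim (0≉1 (sym 1≈0))
  pow≈0⇒≈0 x (suc k) x^k+1≈0 with x*y≈0⇒x≈0⊎y≈0 x^k+1≈0
  ... | inj₁ x≈0   = x≈0
  ... | inj₂ x^k≈0 = pow≈0⇒≈0 x k x^k≈0

  *-cancelʳ-nonzero : ∀ {a p} → ¬ p ≈ 0# → p ≈ a * p → a ≈ 1#
  *-cancelʳ-nonzero {a} {p} p≉0 p≈ap with inverse p p≉0
  ... | p⁻¹ , pp⁻¹≈1 = begin
    a               ≈⟨ *-identityʳ a ⟨
    a * 1#          ≈⟨ *-congˡ pp⁻¹≈1 ⟨
    a * (p * p⁻¹)   ≈⟨ *-assoc _ _ _ ⟨
    (a * p) * p⁻¹   ≈⟨ *-congʳ p≈ap ⟨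
    p * p⁻¹         ≈⟨ pp⁻¹≈1 ⟩
    1#              ∎

  bijection⇒permutation : ∀ (g h : Carrier → Carrier) → Congruent _≈_ _≈_ g → Congruent _≈_ _≈_ h →
                          (∀ x → g (h x) ≈ x) → (∀ x → h (g x) ≈ x) → Permutation q q
  bijection⇒permutation g h g-cong h-cong gh≈id hg≈id =
    mk↔ₛ′ (λ i → index (g (element i))) (λ i → index (h (element i)))
          (transfer g-cong gh≈id) (transfer h-cong hg≈id)
    where
    transfer : ∀ {g h : Carrier → Carrier} → Congruent _≈_ _≈_ g → (∀ x → g (h x) ≈ x) →
               ∀ i → index (g (element (index (h (element i))))) ≡ i
    transfer {g} {h} g-cong gh≈id i =
      ≡.trans (to-cong (trans (g-cong (strictlyInverseʳ _)) (gh≈id (element i)))) (strictlyInverseˡ i)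

  -- Translation by 1 permutes the field, so the sum of all elements equals itself plus q·1.
  natR-card≈0 : natR q ≈ 0#
  natR-card≈0 = +-identityˡ-unique (natR q) total (begin
    natR q + total
      ≈⟨ +-congʳ (trans (reflexive (natR≡×1 q)) (sym (Σ.sum-replicate q))) ⟩
    Σ.sum {q} (λ _ → 1#) + total                        ≈⟨ Σ.∑-distrib-+ (λ _ → 1#) element ⟨
    Σ.sum {q} (λ i → 1# + element i)                    ≈⟨ Σ.sum-cong-≋ {q} (λ i → sym (strictlyInverseʳ _)) ⟩
    Σ.sum {q} (λ i → element (index (1# + element i)))  ≈⟨ Σ.sum-permute element translation ⟨
    total                                               ∎)
    where
    total : Carrier
    total = Σ.sum {q} element
    translation : Permutation q q
    translation = bijection⇒permutation (1# +_) (- 1# +_) +-congˡ +-congˡ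
      (λ x → trans (sym (+-assoc _ _ _)) (trans (+-congʳ (-‿inverseʳ 1#)) (+-identityˡ x)))
      (λ x → trans (sym (+-assoc _ _ _)) (trans (+-congʳ (-‿inverseˡ 1#)) (+-identityˡ x)))

  ifZero_then_else_ : Carrier → Carrier → Carrier → Carrier
  ifZero x then u else v with x ≟ 0#
  ... | yes _ = u
  ... | no  _ = v

  ifZero-yes : ∀ {x} u v → x ≈ 0# → ifZero x then u else v ≈ u
  ifZero-yes {x} u v x≈0 with x ≟ 0#
  ... | yes _   = refl
  ... | no  x≉0 = ⊥-elim (x≉0 x≈0)

  ifZero-no : ∀ {x} u v → ¬ x ≈ 0# → ifZero x then u else v ≈ v
  ifZero-no {x} u v x≉0 with x ≟ 0#
  ... | yes x≈0 = ⊥-elim (x≉0 x≈0)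
  ... | no  _   = refl

  ∏-nonzero : ∀ {n} (t : Fin n → Carrier) → (∀ i → ¬ t i ≈ 0#) → ¬ Π.sum t ≈ 0#
  ∏-nonzero {zero}  t t≉0 1≈0 = 0≉1 (sym 1≈0)
  ∏-nonzero {suc n} t t≉0 =
    *-nonzero (t≉0 Fin.zero) (∏-nonzero (λ i → t (Fin.suc i)) (λ i → t≉0 (Fin.suc i)))

  ∏-const : ∀ n a → Π.sum {n} (λ _ → a) ≈ pow a n
  ∏-const zero    a = refl
  ∏-const (suc n) a = *-congˡ (∏-const n a)

  ∏-oneExcept : ∀ {n} (t : Fin n → Carrier) (i : Fin n) {a} → t i ≈ 1# → (∀ j → j ≢ i → t j ≈ a) →
                Π.sum t ≈ pow a (ℕ.pred n)
  ∏-oneExcept {suc n} t i {a} tᵢ≈1 tⱼ≈a = begin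
    Π.sum t                           ≈⟨ Π.sum-remove t ⟩
    t i * Π.sum (λ j → t (Fin.punchIn i j))
      ≈⟨ *-cong tᵢ≈1 (Π.sum-cong-≋ {n} (λ j → tⱼ≈a _ (Fin.punchInᵢ≢i i j))) ⟩
    1# * Π.sum {n} (λ _ → a)          ≈⟨ *-identityˡ _ ⟩
    Π.sum {n} (λ _ → a)               ≈⟨ ∏-const n a ⟩
    pow a n                           ∎

  nonzeroOr1 : Carrier → Carrier
  nonzeroOr1 x = ifZero x then 1# else x

  nonzeroOr1-nonzero : ∀ x → ¬ nonzeroOr1 x ≈ 0#
  nonzeroOr1-nonzero x with x ≟ 0#
  ... | yes _   = λ 1≈0 → 0≉1 (sym 1≈0)
  ... | no  x≉0 = x≉0

  nonzeroOr1-cong : ∀ {x y} → x ≈ y → nonzeroOr1 x ≈ nonzeroOr1 y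
  nonzeroOr1-cong {x} {y} x≈y with x ≟ 0#
  ... | yes x≈0 = sym (ifZero-yes 1# y (trans (sym x≈y) x≈0))
  ... | no  x≉0 = trans x≈y (sym (ifZero-no 1# y (λ y≈0 → x≉0 (trans x≈y y≈0))))

  nonzeroOr1-* : ∀ {a} → ¬ a ≈ 0# → ∀ x → nonzeroOr1 (a * x) ≈ (ifZero x then 1# else a) * nonzeroOr1 x
  nonzeroOr1-* {a} a≉0 x with x ≟ 0#
  ... | yes x≈0 = trans (ifZero-yes 1# (a * x) (trans (*-congˡ x≈0) (zeroʳ a))) (sym (*-identityˡ 1#))
  ... | no  x≉0 = ifZero-no 1# (a * x) (*-nonzero a≉0 x≉0)

  -- Multiplying by a permutes the field; with 0 replaced by 1, the product P of all elements is the product of the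
  -- nonzero ones, and it becomes P = a^(q-1) P.
  fermat : ∀ {a} → ¬ a ≈ 0# → pow a (ℕ.pred q) ≈ 1#
  fermat {a} a≉0 with inverse a a≉0
  ... | a⁻¹ , aa⁻¹≈1 = *-cancelʳ-nonzero (∏-nonzero (nonzeroOr1 ∘ element) (nonzeroOr1-nonzero ∘ element)) (begin
    P
      ≈⟨ Π.sum-permute (nonzeroOr1 ∘ element) scaling ⟩
    Π.sum {q} (λ i → nonzeroOr1 (element (index (a * element i))))
      ≈⟨ Π.sum-cong-≋ {q} (λ i → trans (nonzeroOr1-cong (strictlyInverseʳ _)) (nonzeroOr1-* a≉0 (element i))) ⟩
    Π.sum {q} (λ i → (ifZero element i then 1# else a) * nonzeroOr1 (element i))
      ≈⟨ Π.∑-distrib-+ (λ i → ifZero element i then 1# else a) (nonzeroOr1 ∘ element) ⟩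
    Π.sum {q} (λ i → ifZero element i then 1# else a) * P
      ≈⟨ *-congʳ (∏-oneExcept _ (index 0#) at-zero elsewhere) ⟩
    pow a (ℕ.pred q) * P
      ∎)
    where
    P : Carrier
    P = Π.sum {q} (nonzeroOr1 ∘ element)
    scaling : Permutation q q
    scaling = bijection⇒permutation (a *_) (a⁻¹ *_) *-congˡ *-congˡ
      (λ x → trans (sym (*-assoc _ _ _)) (trans (*-congʳ aa⁻¹≈1) (*-identityˡ x)))
      (λ x → trans (sym (*-assoc _ _ _)) (trans (*-congʳ (trans (*-comm a⁻¹ a) aa⁻¹≈1)) (*-identityˡ x)))
    at-zero : ifZero element (index 0#) then 1# else a ≈ 1#
    at-zero = ifZero-yes 1# a (strictlyInverseʳ 0#)
    elsewhere : ∀ j → j ≢ index 0# → ifZero element j then 1# else a ≈ a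
    elsewhere j j≢0 = ifZero-no 1# a (λ eⱼ≈0 → j≢0 (≡.trans (≡.sym (strictlyInverseˡ j)) (to-cong eⱼ≈0)))

  pow-card : ∀ x → pow x q ≈ x
  pow-card x = trans (reflexive (≡.cong (pow x) (≡.sym (ℕ.suc-pred q)))) (x*x^pred≈x x)
    where
    instance
      q≢0 : ℕ.NonZero q
      q≢0 = Fin.nonZeroIndex (index 0#)
    x*x^pred≈x : ∀ x → x * pow x (ℕ.pred q) ≈ x
    x*x^pred≈x x with x ≟ 0#
    ... | yes x≈0 = trans (*-congʳ x≈0) (trans (zeroˡ _) (sym x≈0))
    ... | no  x≉0 = trans (*-congˡ (fermat x≉0)) (*-identityʳ x)

  quadraticCharacter : ∀ {h} → q ≡ suc (h ℕ.+ h) → ∀ {x} → ¬ x ≈ 0# → pow x h ≈ 1# ⊎ pow x h ≈ - 1#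
  quadraticCharacter {h} q≡1+2h {x} x≉0 with x*y≈0⇒x≈0⊎y≈0 (begin
    (e - 1#) * (e + 1#)  ≈⟨ [x-1][x+1]≈x*x-1 e ⟩
    e * e - 1#           ≈⟨ +-congʳ (pow-+ x h h) ⟨
    pow x (h ℕ.+ h) - 1# ≈⟨ +-congʳ (trans (reflexive (≡.cong (pow x ∘ ℕ.pred) (≡.sym q≡1+2h))) (fermat x≉0)) ⟩
    1# - 1#              ≈⟨ -‿inverseʳ 1# ⟩
    0#                   ∎)
    where
    e : Carrier
    e = pow x h
  ... | inj₁ e-1≈0 = inj₁ (x∙y⁻¹≈ε⇒x≈y _ _ e-1≈0)
  ... | inj₂ e+1≈0 = inj₂ (+-inverseˡ-unique _ _ e+1≈0)

  injective⇒surjective : ∀ (g : Carrier → Carrier) → Injective _≈_ _≈_ g → ∀ y → ∃ λ x → g x ≈ y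
  injective⇒surjective g g-inj y with Fin-injective⇒surjective h h-inj (index y)
    where
    h : Fin q → Fin q
    h i = index (g (element i))
    h-inj : Injective _≡_ _≡_ h
    h-inj {i} {j} hi≡hj =
      ≡.trans (≡.sym (strictlyInverseˡ i)) (≡.trans (to-cong (g-inj (index-injective hi≡hj))) (strictlyInverseˡ j))
  ... | i , hi≡y = element i , index-injective hi≡y

  leftInverse⇒isPerm : ∀ (g h : Carrier → Carrier) → Congruent _≈_ _≈_ g → Congruent _≈_ _≈_ h →
                       (∀ x → h (g x) ≈ x) → IsPerm g
  leftInverse⇒isPerm g h g-cong h-cong hg≈id = g-inj , λ y → let (x , gx≈y) = injective⇒surjective g g-inj y in
                                                           x , λ z≈x → trans (g-cong z≈x) gx≈y
    where
    g-inj : Injective _≈_ _≈_ g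
    g-inj {x} {y} gx≈gy = trans (sym (hg≈id x)) (trans (h-cong gx≈gy) (hg≈id y))

module InverseOfF {c ℓ} (m : ℕ) (2∣1+m : 2 ∣ suc m) (F : FiniteField (3 ^ suc m) c ℓ) where

  open FiniteField F
  open CommutativeRing cring hiding (zero)
  open Poly cring
  open RingProperties cring
  open FiniteFieldProperties F
  open import Algebra.Properties.Ring ring using (+-inverseˡ-unique)
  open import Relation.Binary.Reasoning.Setoid setoid

  private
    n : ℕ
    n = suc m

  characteristic3 : Characteristic3 cring
  characteristic3 = begin
    1# + 1# + 1#      ≈⟨ +-assoc _ _ _ ⟩
    1# + (1# + 1#)    ≈⟨ +-congˡ (+-congˡ (+-identityʳ 1#)) ⟨
    natR 3            ≈⟨ pow≈0⇒≈0 (natR 3) n (trans (sym (natR-^ 3 n)) natR-card≈0) ⟩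
    0#                ∎

  open CharacteristicThree cring characteristic3

  η : Carrier → Carrier
  η x = pow x ⌊3^ n /2⌋

  η[-1]≈1 : η (- 1#) ≈ 1#
  η[-1]≈1 = sgn-even (2∣⇒2∣⌊3^/2⌋ 2∣1+m)

  1≉-1 : ¬ 1# ≈ - 1#
  1≉-1 1≈-1 = 0≉1 (sym (begin
    1#                 ≈⟨ solve 0 (con 1₃ := :- (con 1₃ :+ con 1₃)) refl ⟩
    - (1# + 1#)        ≈⟨ -‿cong (+-congˡ 1≈-1) ⟩
    - (1# + - 1#)      ≈⟨ -‿cong (-‿inverseʳ 1#) ⟩
    - 0#               ≈⟨ solve 0 (:- con 0₃ := con 0₃) refl ⟩
    0#                 ∎))

  f-square : ∀ {x} → η x ≈ 1# → f n x ≈ - 1# * pow x 3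
  f-square {x} ηx≈1 = trans (f-via-⌊3^/2⌋ n x) (trans (+-congʳ (+-congʳ (*-congˡ ηx≈1)))
    (solve 1 (λ x → ((x :- x :^ 2) :- x :^ 3) :* con 1₃ :- x :+ x :^ 2 := (:- con 1₃) :* x :^ 3) refl x))

  f-nonsquare : ∀ {x} → η x ≈ - 1# → f n x ≈ x * ((x + 1#) * (x + 1#))
  f-nonsquare {x} ηx≈-1 = trans (f-via-⌊3^/2⌋ n x) (trans (+-congʳ (+-congʳ (*-congˡ ηx≈-1)))
    (solve 1 (λ x → ((x :- x :^ 2) :- x :^ 3) :* (:- con 1₃) :- x :+ x :^ 2
                   := x :* ((x :+ con 1₃) :* (x :+ con 1₃))) refl x))

  nonsquare⇒x+1≉0 : ∀ {x} → η x ≈ - 1# → ¬ x + 1# ≈ 0#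
  nonsquare⇒x+1≉0 {x} ηx≈-1 x+1≈0 = 1≉-1 (begin
    1#         ≈⟨ η[-1]≈1 ⟨
    η (- 1#)   ≈⟨ pow-cong ⌊3^ n /2⌋ (sym (+-inverseˡ-unique x 1# x+1≈0)) ⟩
    η x        ≈⟨ ηx≈-1 ⟩
    - 1#       ∎)

  finv∘f-zero : ∀ {x} → x ≈ 0# → finv n (f n x) ≈ x
  finv∘f-zero {x} x≈0 = begin
    finv n (f n x)
      ≈⟨ finv-cong n (trans (f-cong n x≈0) f0≈0) ⟩
    finv n 0#
      ≈⟨ finv-via-S n 0# ⟩
    pow 0# (3 ^ m) * (η 0# + 1#) + 0# * (S n 0# * S n 0#) * (η 0# - 1#)
      ≈⟨ +-congʳ (*-congʳ 0^3^m≈0) ⟩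
    0# * (η 0# + 1#) + 0# * (S n 0# * S n 0#) * (η 0# - 1#)
      ≈⟨ solve 2 (λ e s → con 0₃ :* (e :+ con 1₃) :+ con 0₃ :* (s :* s) :* (e :- con 1₃) := con 0₃)
                 refl (η 0#) (S n 0#) ⟩
    0#
      ≈⟨ x≈0 ⟨
    x ∎
    where
    f0≈0 : f n 0# ≈ 0#
    f0≈0 = solve 1 (λ e → ((con 0₃ :- con 0₃ :^ 2) :- con 0₃ :^ 3) :* e :- con 0₃ :+ con 0₃ :^ 2 := con 0₃)
                   refl (pow 0# (half n))
    0^3^m≈0 : pow 0# (3 ^ m) ≈ 0#
    0^3^m≈0 = trans (reflexive (≡.cong (pow 0#) (3^≡1+2*⌊3^/2⌋ m))) (zeroˡ _)

  finv∘f-square : ∀ {x} → η x ≈ 1# → finv n (f n x) ≈ x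
  finv∘f-square {x} ηx≈1 = begin
    finv n y                                                         ≈⟨ finv-via-S n y ⟩
    pow y (3 ^ m) * (η y + 1#) + y * (S n y * S n y) * (η y - 1#)
      ≈⟨ +-cong (*-cong y^3^m≈-x (+-congʳ ηy≈1)) (*-congˡ (+-congʳ ηy≈1)) ⟩
    - 1# * x * (1# + 1#) + y * (S n y * S n y) * (1# - 1#)
      ≈⟨ solve 2 (λ x w → (:- con 1₃) :* x :* (con 1₃ :+ con 1₃) :+ w :* (con 1₃ :- con 1₃) := x)
                 refl x (y * (S n y * S n y)) ⟩
    x                                                                ∎
    where
    y : Carrier
    y = f n x
    y≈-x³ : y ≈ - 1# * pow x 3
    y≈-x³ = f-square ηx≈1
    ηy≈1 : η y ≈ 1#
    ηy≈1 = begin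
      η y                                      ≈⟨ pow-cong ⌊3^ n /2⌋ y≈-x³ ⟩
      η (- 1# * pow x 3)                       ≈⟨ pow-distrib-* (- 1#) (pow x 3) ⌊3^ n /2⌋ ⟩
      η (- 1#) * pow (pow x 3) ⌊3^ n /2⌋       ≈⟨ *-cong η[-1]≈1 (pow-pow-comm x 3 ⌊3^ n /2⌋) ⟩
      1# * pow (η x) 3                         ≈⟨ *-congˡ (trans (pow-cong 3 ηx≈1) (pow-1# 3)) ⟩
      1# * 1#                                  ≈⟨ *-identityʳ 1# ⟩
      1#                                       ∎
    y^3^m≈-x : pow y (3 ^ m) ≈ - 1# * x
    y^3^m≈-x = begin
      pow y (3 ^ m)                            ≈⟨ pow-cong (3 ^ m) y≈-x³ ⟩
      pow (- 1# * pow x 3) (3 ^ m)             ≈⟨ pow-distrib-* (- 1#) (pow x 3) (3 ^ m) ⟩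
      sgn (3 ^ m) * pow (pow x 3) (3 ^ m)
        ≈⟨ *-cong (trans (reflexive (≡.cong sgn (3^≡1+2*⌊3^/2⌋ m))) (sgn-odd ⌊3^ m /2⌋))
                  (sym (pow-* x 3 (3 ^ m))) ⟩
      - 1# * pow x (3 ^ n)                     ≈⟨ *-congˡ (pow-card x) ⟩
      - 1# * x                                 ∎

  finv∘f-nonsquare : ∀ {x} → η x ≈ - 1# → finv n (f n x) ≈ x
  finv∘f-nonsquare {x} ηx≈-1 = begin
    finv n y                                                         ≈⟨ finv-via-S n y ⟩
    pow y (3 ^ m) * (η y + 1#) + y * (S n y * S n y) * (η y - 1#)
      ≈⟨ +-cong (*-congˡ (+-congʳ ηy≈-1)) (*-cong yS²≈x (+-congʳ ηy≈-1)) ⟩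
    pow y (3 ^ m) * (- 1# + 1#) + x * (- 1# - 1#)
      ≈⟨ solve 2 (λ p x → p :* ((:- con 1₃) :+ con 1₃) :+ x :* ((:- con 1₃) :- con 1₃) := x)
                 refl (pow y (3 ^ m)) x ⟩
    x                                                                ∎
    where
    t : Carrier
    t = x + 1#
    y : Carrier
    y = f n x
    y≈x[x+1]² : y ≈ x * (t * t)
    y≈x[x+1]² = f-nonsquare ηx≈-1
    ηy≈-1 : η y ≈ - 1#
    ηy≈-1 = begin
      η y                                        ≈⟨ pow-cong ⌊3^ n /2⌋ y≈x[x+1]² ⟩
      η (x * (t * t))                            ≈⟨ pow-distrib-* x (t * t) ⌊3^ n /2⌋ ⟩
      η x * η (t * t)
        ≈⟨ *-cong ηx≈-1 (trans (pow-distrib-* t t ⌊3^ n /2⌋) (sym (pow-+ t ⌊3^ n /2⌋ ⌊3^ n /2⌋))) ⟩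
      - 1# * pow t (⌊3^ n /2⌋ ℕ.+ ⌊3^ n /2⌋)
        ≈⟨ *-congˡ (trans (reflexive (≡.cong (pow t ∘ ℕ.pred) (≡.sym (3^≡1+2*⌊3^/2⌋ n))))
                          (fermat (nonsquare⇒x+1≉0 ηx≈-1))) ⟩
      - 1# * 1#                                  ≈⟨ *-identityʳ _ ⟩
      - 1#                                       ∎
    tS≈-1 : t * S n y ≈ - 1#
    tS≈-1 = begin
      t * S n y                  ≈⟨ *-congˡ (S-cong n y≈x[x+1]²) ⟩
      t * S n (x * (t * t))      ≈⟨ S-telescope n x ⟩
      1# - sgn n * η x           ≈⟨ +-congˡ (-‿cong (*-cong (sgn-even 2∣1+m) ηx≈-1)) ⟩
      1# - 1# * - 1#             ≈⟨ solve 0 (con 1₃ :- con 1₃ :* (:- con 1₃) := :- con 1₃) refl ⟩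
      - 1#                       ∎
    yS²≈x : y * (S n y * S n y) ≈ x
    yS²≈x = begin
      y * (S n y * S n y)                  ≈⟨ *-congʳ y≈x[x+1]² ⟩
      x * (t * t) * (S n y * S n y)
        ≈⟨ solve 3 (λ x t s → x :* (t :* t) :* (s :* s) := x :* ((t :* s) :* (t :* s))) refl x t (S n y) ⟩
      x * ((t * S n y) * (t * S n y))      ≈⟨ *-congˡ (*-cong tS≈-1 tS≈-1) ⟩
      x * (- 1# * - 1#)                    ≈⟨ *-congˡ -1*-1≈1 ⟩
      x * 1#                               ≈⟨ *-identityʳ x ⟩
      x                                    ∎

  finv∘f≈id : ∀ x → finv n (f n x) ≈ x
  finv∘f≈id x with x ≟ 0#
  ... | yes x≈0 = finv∘f-zero x≈0
  ... | no  x≉0 with quadraticCharacter {⌊3^ n /2⌋} (3^≡1+2*⌊3^/2⌋ n) x≉0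
  ...   | inj₁ ηx≈1  = finv∘f-square ηx≈1
  ...   | inj₂ ηx≈-1 = finv∘f-nonsquare ηx≈-1

  D : Carrier → Carrier
  D = revDickson (3 ^ n ℕ.+ 5) 1#

  D+1≈f[1-x] : ∀ x → D x + 1# ≈ f n (1# - x)
  D+1≈f[1-x] x = trans (+-congʳ (ReversedDicksonCharacteristicThree.revDickson≈f cring characteristic3 x n))
                       (solve 1 (λ a → a :- con 1₃ :+ con 1₃ := a) refl (f n (1# - x)))

  D-cong : Congruent _≈_ _≈_ D
  D-cong {x} {y} x≈y = begin
    D x                 ≈⟨ solve 1 (λ a → a := a :+ con 1₃ :- con 1₃) refl (D x) ⟩
    D x + 1# - 1#       ≈⟨ +-congʳ (trans (D+1≈f[1-x] x) (f-cong n (+-congˡ (-‿cong x≈y)))) ⟩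
    f n (1# - y) - 1#   ≈⟨ +-congʳ (D+1≈f[1-x] y) ⟨
    D y + 1# - 1#       ≈⟨ solve 1 (λ a → a :+ con 1₃ :- con 1₃ := a) refl (D y) ⟩
    D y                 ∎

  D⁻¹∘D≈id : ∀ x → 1# - finv n (D x + 1#) ≈ x
  D⁻¹∘D≈id x = begin
    1# - finv n (D x + 1#)
      ≈⟨ +-congˡ (-‿cong (trans (finv-cong n (D+1≈f[1-x] x)) (finv∘f≈id (1# - x)))) ⟩
    1# - (1# - x)            ≈⟨ solve 1 (λ x → con 1₃ :- (con 1₃ :- x) := x) refl x ⟩
    x                        ∎

  f-isPerm : IsPerm (f n)
  f-isPerm = leftInverse⇒isPerm (f n) (finv n) (f-cong n) (finv-cong n) finv∘f≈id

  D-isPerm : IsPerm D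
  D-isPerm = leftInverse⇒isPerm D (λ y → 1# - finv n (y + 1#)) D-cong
               (λ y≈z → +-congˡ (-‿cong (finv-cong n (+-congʳ y≈z)))) D⁻¹∘D≈id

theorem1 : {c ℓ : Level} (n : ℕ) → 1 ≤ n → 2 ∣ n → (F : FiniteField (3 ^ n) c ℓ) →
    let open FiniteField F using (cring) in
    let open CommutativeRing cring in
    let open Poly cring in
      IsPerm (f n)
      × (∀ x → finv n (f n x) ≈ x)
      × IsPerm (revDickson (3 ^ n ℕ.+ 5) 1#)
      × (∀ x → (1# - finv n (revDickson (3 ^ n ℕ.+ 5) 1# x + 1#)) ≈ x)
theorem1 (suc m) (s≤s z≤n) 2∣n F = f-isPerm , finv∘f≈id , D-isPerm , D⁻¹∘D≈id
  where open InverseOfF m 2∣n F
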